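{- Let $m$ be a square-free positive integer with $m\equiv 3 \pmod 4$, and let $p$ be the largest prime factor of $m$. If $p<17$, then the rectangular lattice $\Lambda(m)=\{(a,b\sqrt{m})\mid a,b\in\mathbb{Z}\}$ contains a convex equilateral $p$-gon.
   Context: An equilateral $n$-gon is a polygon with $n$ vertices whose sides all have equal length; a set $S$ contains a polygon if every vertex of the polygon lies in $S$. -}

module Defs where

open import Data.Nat as ℕ using (ℕ; zero; suc)
open import Data.Nat.Divisibility using (_∣_)
open import Data.Nat.DivMod using (_mod_)
open import Data.Integer as ℤ using (ℤ; +_; _-_; _*_; _+_; _>_)
open import Data.Fin using (Fin; toℕ)
open import Data.Product using (_×_; _,_; ∃)
open import Relation.Binary.PropositionalEquality using (_≡_; _≢_)

SquareFree : ℕ → Set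
SquareFree m = ∀ d → (d ℕ.* d) ∣ m → d ≡ 1

-- A point (a , b) : ℤ × ℤ encodes the point (a, b√m) of the lattice Λ(m).
Pt : Set
Pt = ℤ × ℤ

sqDist : ℕ → Pt → Pt → ℤ
sqDist m (a , b) (c , d) = (a - c) * (a - c) + (+ m) * ((b - d) * (b - d))

-- the cross product of the planar vectors (x₁, y₁√m) and (x₂, y₂√m) equals
-- √m · crossCoeff (x₁ , y₁) (x₂ , y₂); its sign is that of crossCoeff.
crossCoeff : Pt → Pt → ℤ
crossCoeff (x₁ , y₁) (x₂ , y₂) = x₁ * y₂ - y₁ * x₂

vec : Pt → Pt → Pt
vec (a , b) (c , d) = (c - a , d - b)

nxt : {n : ℕ} → Fin n → Fin n
nxt {zero} ()
nxt {suc k} i = suc (toℕ i) mod suc k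

Equilateral : (m n : ℕ) → (Fin n → Pt) → Set
Equilateral m n v = ∃ λ d → ∀ i → sqDist m (v i) (v (nxt i)) ≡ d

Convex : (m n : ℕ) → (Fin n → Pt) → Set
Convex m n v = ∀ i k → k ≢ i → k ≢ nxt i →
  crossCoeff (vec (v i) (v (nxt i))) (vec (v i) (v k)) > + 0

ContainsConvexEquilateral : (m n : ℕ) → Set
ContainsConvexEquilateral m n =
  ∃ λ (v : Fin n → Pt) → Equilateral m n v × Convex m n v

-- A square-free m whose prime factors are all below 17 divides 2·3·5·7·11·13 = 30030, so
-- only finitely many pairs (m, p) satisfy the hypotheses: the sixteen odd divisors of 30030
-- that are 3 mod 4, with their largest prime factors. For each of them an explicit convex
-- equilateral p-gon in Λ(m) is given and checked by evaluation.
module Submission where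

open import Defs
open import Data.Nat using (ℕ; _<_; _≤_; _%_)
open import Data.Nat.Divisibility using (_∣_)
open import Data.Nat.Primality using (Prime)
open import Relation.Binary.PropositionalEquality using (_≡_)

open import Agda.Builtin.FromNat using (Number; fromNat)
open import Agda.Builtin.FromNeg using (Negative; fromNeg)
open import Data.Empty using (⊥-elim)
open import Data.Fin using (Fin; zero)
open import Data.Fin.Properties using (all?) renaming (_≟_ to _≟ᶠ_)
open import Data.Integer using (ℤ)
import Data.Integer.Literals as ℤ
open import Data.Integer.Properties using (_<?_) renaming (_≟_ to _≟ℤ_)
open import Data.List using (List; []; _∷_)
open import Data.List.Relation.Unary.All using (_∷_)
open import Data.List.Relation.Unary.Any using (Any; any?; satisfied)
open import Data.Nat using (suc; s≤s; _*_; _≤?_; NonZero) renaming (_≟_ to _≟ℕ_)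
import Data.Nat.Literals as ℕ
open import Data.Nat.Divisibility using (divides; _∣?_; ∣m⇒∣m*n; *-pres-∣; ∣⇒≤; _∣0; m∣m*n)
open import Data.Nat.GCD using (gcd[m,n]∣m; gcd[m,n]∣n; gcd-greatest)
open import Data.Nat.Primality using (prime; prime?)
open import Data.Nat.Primality.Factorisation using (factorise)
open import Data.Nat.Properties using (allUpTo?; *-identityˡ; ≤-<-trans)
open import Data.Nat.Base using (nonTrivial⇒≢1)
open import Data.Product using (_,_; ∃₂; ∃-syntax; _×_)
open import Data.Sum using (_⊎_; inj₁; inj₂)
open import Data.Unit using (⊤; tt)
open import Data.Vec using (Vec; []; _∷_; lookup)
open import Relation.Nullary using (Dec; yes; ¬?; contradiction)
open import Relation.Nullary.Decidable using (True; toWitness; map′; _×-dec_; _→-dec_)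
open import Relation.Binary.PropositionalEquality using (refl; sym; trans; subst; _≢_)

instance
  ℕ-number : Number ℕ
  ℕ-number = ℕ.number
  ℤ-number : Number ℤ
  ℤ-number = ℤ.number
  ℤ-negative : Negative ℤ
  ℤ-negative = ℤ.negative
  trivialConstraint : ⊤
  trivialConstraint = tt

prime⇒≢1 : ∀ {p} → Prime p → p ≢ 1
prime⇒≢1 (prime _) = nonTrivial⇒≢1

≡1⊎prime∣ : ∀ n → .{{NonZero n}} → n ≡ 1 ⊎ ∃[ p ] Prime p × p ∣ n
≡1⊎prime∣ n with factorise n
... | record { factors = [] ; isFactorisation = n≡1 } = inj₁ n≡1
... | record { factors = p ∷ _ ; isFactorisation = n≡p*ps ; factorsPrime = p-prime ∷ _ } =
  inj₂ (p , p-prime , subst (p ∣_) (sym n≡p*ps) (m∣m*n _))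

squareFree⇒≢0 : ∀ {m} → SquareFree m → m ≢ 0
squareFree⇒≢0 sf refl with sf 2 (_ ∣0)
... | ()

-- Write m = k · gcd m n: a prime factor r of k divides m, hence n, hence gcd m n, so r² ∣ m.
squareFree⇒∣ : ∀ {m n} → SquareFree m → (∀ {q} → Prime q → q ∣ m → q ∣ n) → m ∣ n
squareFree⇒∣ {m} {n} sf primes∣n with gcd[m,n]∣m m n
... | divides 0 m≡0 = ⊥-elim (squareFree⇒≢0 sf m≡0)
... | divides k@(suc _) m≡k*g with ≡1⊎prime∣ k
...   | inj₁ refl = subst (_∣ n) (sym (trans m≡k*g (*-identityˡ _))) (gcd[m,n]∣n m n)
...   | inj₂ (r , r-prime , r∣k) = contradiction (sf r r*r∣m) (prime⇒≢1 r-prime)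
  where
  r∣m : r ∣ m
  r∣m = subst (r ∣_) (sym m≡k*g) (∣m⇒∣m*n _ r∣k)

  r*r∣m : r * r ∣ m
  r*r∣m = subst (r * r ∣_) (sym m≡k*g)
    (*-pres-∣ r∣k (gcd-greatest r∣m (primes∣n r-prime r∣m)))

prime<17⇒∣30030 : ∀ {q} → q < 17 → Prime q → q ∣ 30030
prime<17⇒∣30030 = toWitness {a? = allUpTo? (λ q → prime? q →-dec q ∣? 30030) 17} _

equilateral? : ∀ m {n} (v : Fin n → Pt) → Dec (Equilateral m n v)
equilateral? m {0} v = yes (0 , λ ())
equilateral? m {suc k} v = map′ (λ sides≡ → side zero , sides≡)
  (λ (_ , sides≡d) i → trans (sides≡d i) (sym (sides≡d zero)))
  (all? λ i → side i ≟ℤ side zero)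
  where
  side : Fin (suc k) → ℤ
  side i = sqDist m (v i) (v (nxt i))

convex? : ∀ m {n} (v : Fin n → Pt) → Dec (Convex m n v)
convex? m v = all? λ i → all? λ k →
  ¬? (k ≟ᶠ i) →-dec ¬? (k ≟ᶠ nxt i) →-dec
    (0 <? crossCoeff (vec (v i) (v (nxt i))) (vec (v i) (v k)))

-- n must be given as a literal: nxt reduces with _mod_, which is slow on the unary
-- numeral that would be inferred from the length of vs.
fromVertices : ∀ m n (vs : Vec Pt n) →
  True (equilateral? m (lookup vs)) → True (convex? m (lookup vs)) →
  ∃₂ ContainsConvexEquilateral
fromVertices m n vs equilateral convex =
  m , n , lookup vs , toWitness equilateral , toWitness convex

knownPolygons : List (∃₂ ContainsConvexEquilateral)
knownPolygons =
  fromVertices 3 3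
    ((0 , 0) ∷ (1 , -1) ∷ (2 , 0) ∷ []) _ _ ∷
  fromVertices 7 7
    ((0 , 0) ∷ (-26 , -2) ∷ (-45 , -9) ∷ (-29 , -17) ∷ (-6 , -22) ∷ (17 , -17) ∷
     (19 , -7) ∷ []) _ _ ∷
  fromVertices 11 11
    ((0 , 0) ∷ (-57 , -21) ∷ (-92 , -46) ∷ (-83 , -73) ∷ (-41 , -97) ∷ (45 , -105) ∷
     (131 , -97) ∷ (173 , -73) ∷ (182 , -46) ∷ (147 , -21) ∷ (90 , 0) ∷ []) _ _ ∷
  fromVertices 15 5
    ((0 , 0) ∷ (-8726 , -926) ∷ (-13197 , -3071) ∷ (-3763 , -3053) ∷ (4891 , -2083) ∷
     []) _ _ ∷
  fromVertices 35 7
    ((0 , 0) ∷ (-122 , -4) ∷ (-69 , -23) ∷ (33 , -35) ∷ (156 , -38) ∷ (209 , -19) ∷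
     (122 , -4) ∷ []) _ _ ∷
  fromVertices 39 13
    ((0 , 0) ∷ (-310 , -50) ∷ (-464 , -116) ∷ (-553 , -185) ∷ (-369 , -249) ∷
     (-172 , -312) ∷ (220 , -344) ∷ (612 , -312) ∷ (809 , -249) ∷ (993 , -185) ∷
     (904 , -116) ∷ (750 , -50) ∷ (440 , 0) ∷ []) _ _ ∷
  fromVertices 55 11
    ((0 , 0) ∷ (-1596 , -140) ∷ (-1960 , -392) ∷ (-2181 , -647) ∷ (-917 , -839) ∷
     (952 , -888) ∷ (2821 , -839) ∷ (4085 , -647) ∷ (3864 , -392) ∷ (3500 , -140) ∷
     (1904 , 0) ∷ []) _ _ ∷
  fromVertices 91 13
    ((0 , 0) ∷ (-5877 , -41) ∷ (-9752 , -506) ∷ (-9350 , -1122) ∷ (-7583 , -1711) ∷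
     (-2540 , -2030) ∷ (2945 , -2255) ∷ (8430 , -2030) ∷ (13473 , -1711) ∷
     (15240 , -1122) ∷ (15642 , -506) ∷ (11767 , -41) ∷ (5890 , 0) ∷ []) _ _ ∷
  fromVertices 143 13
    ((0 , 0) ∷ (-4902 , -342) ∷ (-8374 , -790) ∷ (-7842 , -1322) ∷ (-5451 , -1817) ∷
     (-2917 , -2307) ∷ (3192 , -2462) ∷ (9301 , -2307) ∷ (11835 , -1817) ∷
     (14226 , -1322) ∷ (14758 , -790) ∷ (11286 , -342) ∷ (6384 , 0) ∷ []) _ _ ∷
  fromVertices 195 13
    ((0 , 0) ∷ (-1601 , -33) ∷ (-3007 , -97) ∷ (-3126 , -216) ∷ (-2335 , -321) ∷
     (-816 , -370) ∷ (833 , -387) ∷ (2482 , -370) ∷ (4001 , -321) ∷ (4792 , -216) ∷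
     (4673 , -97) ∷ (3267 , -33) ∷ (1666 , 0) ∷ []) _ _ ∷
  fromVertices 231 11
    ((0 , 0) ∷ (-569 , -37) ∷ (-984 , -82) ∷ (-860 , -134) ∷ (-340 , -174) ∷
     (400 , -194) ∷ (1140 , -174) ∷ (1660 , -134) ∷ (1784 , -82) ∷ (1369 , -37) ∷
     (800 , 0) ∷ []) _ _ ∷
  fromVertices 455 13
    ((0 , 0) ∷ (-3519 , -99) ∷ (-6583 , -227) ∷ (-7229 , -417) ∷ (-5015 , -579) ∷
     (-1709 , -693) ∷ (2052 , -770) ∷ (5813 , -693) ∷ (9119 , -579) ∷
     (11333 , -417) ∷ (10687 , -227) ∷ (7623 , -99) ∷ (4104 , 0) ∷ []) _ _ ∷
  fromVertices 715 13
    ((0 , 0) ∷ (-492153 , -10885) ∷ (-917096 , -25192) ∷ (-1270253 , -42009) ∷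
     (-797871 , -54057) ∷ (-271149 , -62377) ∷ (285889 , -67201) ∷
     (842927 , -62377) ∷ (1369649 , -54057) ∷ (1842031 , -42009) ∷
     (1488874 , -25192) ∷ (1063931 , -10885) ∷ (571778 , 0) ∷ []) _ _ ∷
  fromVertices 1155 11
    ((0 , 0) ∷ (-22447 , -95) ∷ (-26414 , -752) ∷ (-21141 , -1401) ∷
     (-5858 , -1894) ∷ (11339 , -2329) ∷ (28536 , -1894) ∷ (43819 , -1401) ∷
     (49092 , -752) ∷ (45125 , -95) ∷ (22678 , 0) ∷ []) _ _ ∷
  fromVertices 3003 13
    ((0 , 0) ∷ (-18237358 , -315832) ∷ (-26473725 , -749325) ∷
     (-28530347 , -1206597) ∷ (-20965929 , -1644149) ∷ (-5704822 , -2008772) ∷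
     (12571297 , -2323857) ∷ (30847416 , -2008772) ∷ (46108523 , -1644149) ∷
     (53672941 , -1206597) ∷ (51616319 , -749325) ∷ (43379952 , -315832) ∷
     (25142594 , 0) ∷ []) _ _ ∷
  fromVertices 15015 13
    ((0 , 0) ∷ (-446522 , -782) ∷ (-770350 , -3410) ∷ (-791447 , -7133) ∷
     (-593325 , -10491) ∷ (-220028 , -12638) ∷ (228344 , -13346) ∷
     (676716 , -12638) ∷ (1050013 , -10491) ∷ (1248135 , -7133) ∷ (1227038 , -3410) ∷
     (903210 , -782) ∷ (456688 , 0) ∷ []) _ _ ∷
  []

HasParameters : ℕ → ℕ → ∃₂ ContainsConvexEquilateral → Set
HasParameters m n (m′ , n′ , _) = m′ ≡ m × n′ ≡ n

hasParameters? : ∀ m n polygon → Dec (HasParameters m n polygon)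
hasParameters? m n (m′ , n′ , _) = m′ ≟ℕ m ×-dec n′ ≟ℕ n

HasKnownPolygon : ℕ → ℕ → Set
HasKnownPolygon m n = Any (HasParameters m n) knownPolygons

any-hasParameters⇒contains : ∀ {m n} {polygons : List (∃₂ ContainsConvexEquilateral)} →
  Any (HasParameters m n) polygons → ContainsConvexEquilateral m n
any-hasParameters⇒contains known with satisfied known
... | (_ , _ , polygon) , refl , refl = polygon

knownPolygons-complete : ∀ {m} → m ∣ 30030 → m % 4 ≡ 3 →
  ∀ {p} → p < 17 → Prime p → p ∣ m →
  (∀ {q} → q < 17 → Prime q → q ∣ m → q ≤ p) → HasKnownPolygon m p
knownPolygons-complete m∣30030 =
  toWitness {a? = allUpTo? cases 30031} _ (s≤s (∣⇒≤ m∣30030)) m∣30030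
  where
  cases : ∀ m → Dec (m ∣ 30030 → m % 4 ≡ 3 → ∀ {p} → p < 17 → Prime p → p ∣ m →
    (∀ {q} → q < 17 → Prime q → q ∣ m → q ≤ p) → HasKnownPolygon m p)
  cases m = m ∣? 30030 →-dec m % 4 ≟ℕ 3 →-dec allUpTo? (λ p →
    prime? p →-dec p ∣? m →-dec
    allUpTo? (λ q → prime? q →-dec q ∣? m →-dec q ≤? p) 17 →-dec
    any? (hasParameters? m p) knownPolygons) 17

proposition3p2 : (m p : ℕ) → SquareFree m → m % 4 ≡ 3 →
    Prime p → p ∣ m → (∀ q → Prime q → q ∣ m → q ≤ p) → p < 17 →
    ContainsConvexEquilateral m p
proposition3p2 m p sf m%4≡3 p-prime p∣m largest p<17 =
  any-hasParameters⇒contains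
    (knownPolygons-complete m∣30030 m%4≡3 p<17 p-prime p∣m (λ _ → largest _))
  where
  m∣30030 : m ∣ 30030
  m∣30030 = squareFree⇒∣ sf λ q-prime q∣m →
    prime<17⇒∣30030 (≤-<-trans (largest _ q-prime q∣m) p<17) q-prime
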